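{- Let $n,m\ge3$ be odd integers and let $S$ and $T$ be 2-partitions of $\mathbb{Z}_n^*$ and $\mathbb{Z}_m^*$ respectively, and let $W_{ST}$ be any product of $S$ and $T$. Then $W_{ST}$ is a strong 2-partition of $\mathbb{Z}_{mn}^*$ if and only if $S$ is strong and $T$ is skew.
   Context: $\mathbb{Z}_k^*=\mathbb{Z}_k\setminus\{0\}$; a 2-partition of $\mathbb{Z}_k^*$ ($k$ odd) is a partition into unordered pairs $\{x_i,y_i\}$. It is strong if the sums $x_i+y_i\bmod k$ are all nonzero and pairwise distinct; skew if $\{\pm(x_i+y_i)\bmod k\}=\mathbb{Z}_k^*$. Product: let $n=2q+1$, $m=2p+1$. Let $\tilde S$ be any set of ordered pairs obtained by ordering each pair of $S$ in either way. Let $\bar T=\{(r_j,t_j)\}_{j=1}^p$ be obtained by ordering each pair of $T$ so that $\bigcup_j\{\pm r_j\}=\mathbb{Z}_m^*$, and $\bar T'=\{(-r_j,-t_j)\}_{j=1}^p$. A product $W_{ST}$ is the collection of unordered pairs $\{nr+x,\ nt+y\}$ (mod $nm$, with $x,y$ represented in $\{0,\dots,n-1\}$) of two types: (i) one pair for each $(r,t)\in\bar T\cup\bar T'\cup\{(0,0)\}$ and each $(x,y)\in\tilde S$; (ii) one pair for each $(r,t)\in\bar T$ with $x=y=0$. -}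

module Defs where

open import Data.Nat using (ℕ; zero; suc; _+_; _*_; _∸_; _<_; _≤_)
open import Data.Nat.DivMod using (_%_)
open import Data.Product using (_×_; _,_; proj₁; proj₂)
open import Data.Sum using (_⊎_)
open import Data.List using (List; []; _∷_; _++_; map; concatMap; upTo)
open import Data.List.Membership.Propositional using (_∈_)
open import Data.List.Relation.Unary.All using (All)
open import Data.List.Relation.Unary.Unique.Propositional using (Unique)
open import Data.List.Relation.Binary.Pointwise using (Pointwise)
open import Data.List.Relation.Binary.Permutation.Propositional using (_↭_)
open import Relation.Binary.PropositionalEquality using (_≡_; _≢_)
open import Function.Bundles using (_⇔_)

-- Elements of ℤ_k are represented by their canonical residues 0,…,k-1 in ℕ.
-- Reduction mod k (k = 0 never occurs in the theorem, since k ≥ 3).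
md : ℕ → ℕ → ℕ
md a zero    = a
md a (suc k) = a % suc k

neg : ℕ → ℕ → ℕ
neg k a = md (k ∸ md a k) k

ZStar : ℕ → List ℕ
ZStar k = map suc (upTo (k ∸ 1))

-- A (candidate) collection of pairs; each unordered pair {x,y} is stored as
-- an ordered pair (x , y) in some order.
Pairs : Set
Pairs = List (ℕ × ℕ)

entries : Pairs → List ℕ
entries = concatMap (λ p → proj₁ p ∷ proj₂ p ∷ [])

IsTwoPartition : ℕ → Pairs → Set
IsTwoPartition k P = entries P ↭ ZStar k

sums : ℕ → Pairs → List ℕ
sums k = map (λ p → md (proj₁ p + proj₂ p) k)

Strong : ℕ → Pairs → Set
Strong k P = All (λ s → s ≢ 0) (sums k P) × Unique (sums k P)

Skew : ℕ → Pairs → Set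
Skew k P = ∀ z → (z ∈ concatMap (λ s → s ∷ neg k s ∷ []) (sums k P)) ⇔ (z ∈ ZStar k)

swap : ℕ × ℕ → ℕ × ℕ
swap p = proj₂ p , proj₁ p

IsOrdering : Pairs → Pairs → Set
IsOrdering P Q = Pointwise (λ p q → q ≡ p ⊎ q ≡ swap p) P Q

IsBarOrdering : ℕ → Pairs → Pairs → Set
IsBarOrdering m T Tb =
  IsOrdering T Tb × (∀ z → (z ∈ concatMap (λ p → proj₁ p ∷ neg m (proj₁ p) ∷ []) Tb) ⇔ (z ∈ ZStar m))

barNeg : ℕ → Pairs → Pairs
barNeg m = map (λ p → neg m (proj₁ p) , neg m (proj₂ p))

-- The product W_ST (mod n·m), given S̃ (St) and T̄ (Tb).
product : ℕ → ℕ → Pairs → Pairs → Pairs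
product n m St Tb = typeI ++ typeII
  where
  N : ℕ
  N = n * m
  typeI : Pairs
  typeI = concatMap
    (λ rt → map (λ xy → md (n * proj₁ rt + proj₁ xy) N , md (n * proj₂ rt + proj₂ xy) N) St)
    (Tb ++ barNeg m Tb ++ ((0 , 0) ∷ []))
  typeII : Pairs
  typeII = map (λ rt → md (n * proj₁ rt) N , md (n * proj₂ rt) N) Tb

-- Write z ∈ ℤ_nm in base n as z = n a + b with a ∈ ℤ_m and b ∈ ℤ_n. The pair of W_ST built from
-- (r , t) ∈ R = T̄ ∪ T̄' ∪ {(0 , 0)} and (x , y) ∈ S̃ (or (0 , 0) for type (ii)) has entries n r + x and
-- n t + y, and sum n ((c + r + t) mod m) + (x + y) mod n, where c = ⌊(x + y) / n⌋ is the carry.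
-- Everything is then a count of multiplicities, digit by digit. Both coordinate lists of R enumerate
-- ℤ_m (this is where the condition on T̄ enters), so W_ST is always a 2-partition. The sums of R have
-- m elements and are {± s_j} ∪ {0}, so they are distinct iff T is skew; a shift by the carry does not
-- affect distinctness. The number of sums of W_ST equal to n a + b is
--   Σ_{(x,y) ∈ S̃, x + y ≡ b} #{(r , t) ∈ R : c + r + t ≡ a}  +  [b = 0] · #{j : s_j ≡ a},
-- and summing over a shows that m · #{x + y ≡ b} is at most the number of sums of W_ST in the class
-- b mod n. Hence W_ST strong forces S strong and the sums of R distinct; conversely these two
-- conditions bound every count by 1.

module Submission where

open import Data.Nat using (ℕ; zero; suc; pred; _+_; _*_; _∸_; _<_; _≤_; _≟_; _<?_; z≤n; s≤s; _%_; _/_)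
open import Data.Nat.Properties
open import Data.Nat.DivMod
open import Data.Nat.Divisibility using (divides; divides-refl)
open import Data.Nat.Solver using (module +-*-Solver)
open +-*-Solver using (solve; _:+_; _:*_; con; _:=_)
open import Algebra.Properties.CommutativeSemigroup +-commutativeSemigroup using (interchange)
open import Data.Product using (_×_; _,_; proj₁; proj₂; ∃)
open import Data.Sum using (inj₁; inj₂)
open import Data.Empty using (⊥-elim)
open import Data.List using (List; []; _∷_; _++_; map; concatMap; length; upTo)
open import Data.List.Properties using (length-map; length-upTo; length-++; map-upTo)
open import Data.List.Membership.Propositional using (_∈_; _∉_)
open import Data.List.Membership.Propositional.Properties using (∈-∃++; ∈-map⁻; ∈-++⁻; ∈-upTo⁺; ∈-upTo⁻)
open import Data.List.Membership.DecPropositional _≟_ using (_∈?_)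
open import Data.List.Relation.Unary.Any using (here; there)
open import Data.List.Relation.Unary.All using (All; []; _∷_)
open import Data.List.Relation.Unary.All.Properties.Core using (¬Any⇒All¬)
import Data.List.Relation.Unary.AllPairs as AllPairs
import Data.List.Relation.Unary.AllPairs.Properties as AllPairs
open import Data.List.Relation.Unary.Unique.Propositional using (Unique; []; _∷_)
import Data.List.Relation.Unary.Unique.Propositional.Properties as Unique
open import Data.List.Relation.Binary.Pointwise using ([]; _∷_)
open import Data.List.Relation.Binary.Subset.Propositional using (_⊆_)
open import Data.List.Relation.Binary.Permutation.Propositional using (_↭_; ↭-sym; ↭-trans)
import Data.List.Relation.Binary.Permutation.Propositional as ↭
open import Data.List.Relation.Binary.Permutation.Propositional.Properties using (shift; ∈-resp-↭; ↭-length)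
open import Function using (id; _∘_; _∘′_)
open import Function.Bundles using (_⇔_; mk⇔; Equivalence)
open import Relation.Nullary using (yes; no)
open import Relation.Binary.PropositionalEquality
open import Defs

-- Sums over lists and multiplicities

private
  variable
    A B : Set

δ : ℕ → ℕ → ℕ
δ a b with a ≟ b
... | yes _ = 1
... | no  _ = 0

δ-refl : ∀ a → δ a a ≡ 1
δ-refl a with a ≟ a
... | yes _ = refl
... | no a≢a = ⊥-elim (a≢a refl)

δ-≢ : ∀ {a b} → a ≢ b → δ a b ≡ 0
δ-≢ {a} {b} a≢b with a ≟ b
... | yes a≡b = ⊥-elim (a≢b a≡b)
... | no  _   = refl

δ-sym : ∀ a b → δ a b ≡ δ b a
δ-sym a b with a ≟ b
... | yes refl = sym (δ-refl a)
... | no  a≢b  = sym (δ-≢ (a≢b ∘′ sym))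

∑ : List A → (A → ℕ) → ℕ
∑ []       g = 0
∑ (x ∷ xs) g = g x + ∑ xs g

module _ {g h : A → ℕ} where

  ∑-cong : ∀ xs → (∀ {x} → x ∈ xs → g x ≡ h x) → ∑ xs g ≡ ∑ xs h
  ∑-cong []       _   = refl
  ∑-cong (x ∷ xs) g≡h = cong₂ _+_ (g≡h (here refl)) (∑-cong xs (g≡h ∘ there))

  ∑-mono : ∀ xs → (∀ {x} → x ∈ xs → g x ≤ h x) → ∑ xs g ≤ ∑ xs h
  ∑-mono []       _   = z≤n
  ∑-mono (x ∷ xs) g≤h = +-mono-≤ (g≤h (here refl)) (∑-mono xs (g≤h ∘ there))

  ∑-squeeze : ∀ xs → (∀ {x} → x ∈ xs → g x ≤ h x) → ∑ xs h ≤ ∑ xs g → ∀ {x} → x ∈ xs → g x ≡ h x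
  ∑-squeeze (y ∷ ys) g≤h ∑h≤∑g (here refl) =
    ≤-antisym (g≤h (here refl))
      (+-cancelʳ-≤ _ _ _ (≤-trans (+-monoʳ-≤ (h y) (∑-mono ys (g≤h ∘ there))) ∑h≤∑g))
  ∑-squeeze (y ∷ ys) g≤h ∑h≤∑g (there x∈ys) =
    ∑-squeeze ys (g≤h ∘ there)
      (+-cancelˡ-≤ (h y) _ _ (≤-trans ∑h≤∑g (+-monoˡ-≤ _ (g≤h (here refl))))) x∈ys

∑-++ : ∀ xs ys (g : A → ℕ) → ∑ (xs ++ ys) g ≡ ∑ xs g + ∑ ys g
∑-++ []       ys g = refl
∑-++ (x ∷ xs) ys g = trans (cong (g x +_) (∑-++ xs ys g)) (sym (+-assoc (g x) _ _))

∑-map : ∀ (f : B → A) xs (g : A → ℕ) → ∑ (map f xs) g ≡ ∑ xs (g ∘ f)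
∑-map f []       g = refl
∑-map f (x ∷ xs) g = cong (g (f x) +_) (∑-map f xs g)

∑-concatMap : ∀ (f : B → List A) xs (g : A → ℕ) → ∑ (concatMap f xs) g ≡ ∑ xs (λ x → ∑ (f x) g)
∑-concatMap f []       g = refl
∑-concatMap f (x ∷ xs) g = trans (∑-++ (f x) _ g) (cong (∑ (f x) g +_) (∑-concatMap f xs g))

∑-zero : ∀ (xs : List A) → ∑ xs (λ _ → 0) ≡ 0
∑-zero []       = refl
∑-zero (x ∷ xs) = ∑-zero xs

∑-one : ∀ (xs : List A) → ∑ xs (λ _ → 1) ≡ length xs
∑-one []       = refl
∑-one (x ∷ xs) = cong suc (∑-one xs)

∑-+ : ∀ xs (g h : A → ℕ) → ∑ xs (λ x → g x + h x) ≡ ∑ xs g + ∑ xs h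
∑-+ []       g h = refl
∑-+ (x ∷ xs) g h = trans (cong (g x + h x +_) (∑-+ xs g h)) (interchange (g x) (h x) _ _)

∑-*ˡ : ∀ xs c (g : A → ℕ) → ∑ xs (λ x → c * g x) ≡ c * ∑ xs g
∑-*ˡ []       c g = sym (*-zeroʳ c)
∑-*ˡ (x ∷ xs) c g = trans (cong (c * g x +_) (∑-*ˡ xs c g)) (sym (*-distribˡ-+ c (g x) _))

∑-*ʳ : ∀ xs c (g : A → ℕ) → ∑ xs (λ x → g x * c) ≡ ∑ xs g * c
∑-*ʳ []       c g = refl
∑-*ʳ (x ∷ xs) c g = trans (cong (g x * c +_) (∑-*ʳ xs c g)) (sym (*-distribʳ-+ c (g x) _))

∑-comm : ∀ xs (ys : List B) (g : A → B → ℕ) → ∑ xs (λ x → ∑ ys (g x)) ≡ ∑ ys (λ y → ∑ xs (λ x → g x y))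
∑-comm []       ys g = sym (∑-zero ys)
∑-comm (x ∷ xs) ys g = trans (cong (∑ ys (g x) +_) (∑-comm xs ys g)) (sym (∑-+ ys (g x) _))

∑-∈ : ∀ {xs x} (g : A → ℕ) → x ∈ xs → g x ≤ ∑ xs g
∑-∈ {xs = y ∷ xs} g (here refl) = m≤m+n (g y) _
∑-∈ {xs = y ∷ xs} g (there x∈xs) = ≤-trans (∑-∈ g x∈xs) (m≤n+m _ (g y))

∑-product : ∀ xs (ys : List B) (g : A → ℕ) (h : B → ℕ) → ∑ xs (λ x → ∑ ys (λ y → g x * h y)) ≡ ∑ xs g * ∑ ys h
∑-product xs ys g h = trans (∑-cong xs (λ {x} _ → ∑-*ˡ ys (g x) h)) (∑-*ʳ xs (∑ ys h) g)

∑-≤-length : ∀ xs {g : A → ℕ} → (∀ {x} → x ∈ xs → g x ≤ 1) → ∑ xs g ≤ length xs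
∑-≤-length xs g≤1 = ≤-trans (∑-mono xs g≤1) (≤-reflexive (∑-one xs))

∑-δ-≥ : ∀ {k a} xs {f : A → ℕ} → (∀ {x} → x ∈ xs → f x < k) → k ≤ a → ∑ xs (λ x → δ (f x) a) ≡ 0
∑-δ-≥ xs f<k k≤a = trans (∑-cong xs (λ x∈xs → δ-≢ (λ fx≡a → <⇒≱ (f<k x∈xs) (subst (_ ≤_) (sym fx≡a) k≤a)))) (∑-zero xs)

count : ℕ → List ℕ → ℕ
count z xs = ∑ xs (λ x → δ x z)

module _ {z : ℕ} where

  ∈⇒count>0 : ∀ {xs} → z ∈ xs → 0 < count z xs
  ∈⇒count>0 z∈xs = ≤-trans (≤-reflexive (sym (δ-refl z))) (∑-∈ (λ x → δ x z) z∈xs)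

  count>0⇒∈ : ∀ xs → 0 < count z xs → z ∈ xs
  count>0⇒∈ (x ∷ xs) count>0 with x ≟ z
  ... | yes refl = here refl
  ... | no  _    = there (count>0⇒∈ xs count>0)

  ∉⇒count≡0 : ∀ xs → z ∉ xs → count z xs ≡ 0
  ∉⇒count≡0 xs z∉xs = n≤0⇒n≡0 (≮⇒≥ (z∉xs ∘ count>0⇒∈ xs))

  ↭⇒count≡ : ∀ {xs ys} → xs ↭ ys → count z xs ≡ count z ys
  ↭⇒count≡ ↭.refl              = refl
  ↭⇒count≡ (↭.prep x p)        = cong (δ x z +_) (↭⇒count≡ p)
  ↭⇒count≡ (↭.swap x y p)      = trans (sym (+-assoc (δ x z) _ _))
    (trans (cong₂ _+_ (+-comm (δ x z) (δ y z)) (↭⇒count≡ p)) (+-assoc (δ y z) _ _))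
  ↭⇒count≡ (↭.trans p q)       = trans (↭⇒count≡ p) (↭⇒count≡ q)

  Unique⇒count≤1 : ∀ {xs} → Unique xs → count z xs ≤ 1
  Unique⇒count≤1 []                          = z≤n
  Unique⇒count≤1 {x ∷ xs} x∷xs!@(_ ∷ xs!) with x ≟ z
  ... | yes refl = s≤s (≤-reflexive (∉⇒count≡0 xs (Unique.Unique[x∷xs]⇒x∉xs x∷xs!)))
  ... | no  _    = Unique⇒count≤1 xs!

  Unique⇒count≡1 : ∀ {xs} → Unique xs → z ∈ xs → count z xs ≡ 1
  Unique⇒count≡1 xs! z∈xs = ≤-antisym (Unique⇒count≤1 xs!) (∈⇒count>0 z∈xs)

count≤1⇒Unique : ∀ xs → (∀ z → count z xs ≤ 1) → Unique xs
count≤1⇒Unique []       _     = []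
count≤1⇒Unique (x ∷ xs) count≤1 =
  ¬Any⇒All¬ xs x∉xs ∷ count≤1⇒Unique xs (λ z → ≤-trans (m≤n+m _ (δ x z)) (count≤1 z))
  where
  x∉xs : x ∉ xs
  x∉xs x∈xs = <⇒≱ (+-mono-≤ (≤-reflexive (sym (δ-refl x))) (∈⇒count>0 x∈xs)) (count≤1 x)

All≢⇒count≡0 : ∀ {z xs} → All (_≢ z) xs → count z xs ≡ 0
All≢⇒count≡0 []         = refl
All≢⇒count≡0 (x≢z ∷ ps) = cong₂ _+_ (δ-≢ x≢z) (All≢⇒count≡0 ps)

count≡0⇒All≢ : ∀ {z} xs → count z xs ≡ 0 → All (_≢ z) xs
count≡0⇒All≢ []       _       = []
count≡0⇒All≢ (x ∷ xs) count≡0 =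
  (λ { refl → 0≢1+n (trans (sym (m+n≡0⇒m≡0 (δ x x) count≡0)) (δ-refl x)) })
  ∷ count≡0⇒All≢ xs (m+n≡0⇒n≡0 (δ x _) count≡0)

count≡⇒↭ : ∀ xs ys → (∀ z → count z xs ≡ count z ys) → xs ↭ ys
count≡⇒↭ []       []       _        = ↭.refl
count≡⇒↭ []       (y ∷ ys) count≡   = ⊥-elim (<⇒≢ (∈⇒count>0 {y} {y ∷ ys} (here refl)) (count≡ y))
count≡⇒↭ (x ∷ xs) ys       count≡
  with as , bs , refl ← ∈-∃++ (count>0⇒∈ ys (≤-trans (∈⇒count>0 {x} {x ∷ xs} (here refl)) (≤-reflexive (count≡ x))))
  = ↭-trans (↭.prep x (count≡⇒↭ xs (as ++ bs) count≡′)) (↭-sym (shift x as bs))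
  where
  count≡′ : ∀ z → count z xs ≡ count z (as ++ bs)
  count≡′ z = +-cancelˡ-≡ (δ x z) _ _ (trans (count≡ z) (↭⇒count≡ (shift x as bs)))

∑-count : ∀ {us xs} → Unique us → xs ⊆ us → ∑ us (λ u → count u xs) ≡ length xs
∑-count {us} {xs} us! xs⊆us = begin
  ∑ us (λ u → ∑ xs (λ x → δ x u))  ≡⟨ ∑-comm us xs (λ u x → δ x u) ⟩
  ∑ xs (λ x → ∑ us (λ u → δ x u))  ≡⟨ ∑-cong xs (λ x∈xs → trans (∑-cong us (λ {u} _ → δ-sym _ u))
                                                            (Unique⇒count≡1 us! (xs⊆us x∈xs))) ⟩
  ∑ xs (λ _ → 1)                   ≡⟨ ∑-one xs ⟩
  length xs                        ∎
  where open ≡-Reasoning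

module _ {xs ys : List ℕ} (ys! : Unique ys) (length≡ : length xs ≡ length ys) where

  private
    count≡-off : ∀ {z} → (z ∈ xs → z ∈ ys) → z ∉ ys → count z xs ≡ count z ys
    count≡-off xs⊆ys z∉ys = trans (∉⇒count≡0 _ (z∉ys ∘ xs⊆ys)) (sym (∉⇒count≡0 _ z∉ys))

    ∑-count≡ : xs ⊆ ys → ∑ ys (λ u → count u ys) ≡ ∑ ys (λ u → count u xs)
    ∑-count≡ xs⊆ys = trans (∑-count ys! id) (trans (sym length≡) (sym (∑-count ys! xs⊆ys)))

  sameElements⇒count≡ : (∀ z → z ∈ xs ⇔ z ∈ ys) → ∀ z → count z xs ≡ count z ys
  sameElements⇒count≡ xs≈ys z with z ∈? ys
  ... | no  z∉ys = count≡-off (Equivalence.to (xs≈ys z)) z∉ys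
  ... | yes z∈ys = sym (∑-squeeze ys count≤ (≤-reflexive (sym (∑-count≡ xs⊆ys))) z∈ys)
    where
    xs⊆ys : xs ⊆ ys
    xs⊆ys = Equivalence.to (xs≈ys _)
    count≤ : ∀ {u} → u ∈ ys → count u ys ≤ count u xs
    count≤ u∈ys = ≤-trans (≤-reflexive (Unique⇒count≡1 ys! u∈ys)) (∈⇒count>0 (Equivalence.from (xs≈ys _) u∈ys))

  Unique⊆⇒count≡ : Unique xs → xs ⊆ ys → ∀ z → count z xs ≡ count z ys
  Unique⊆⇒count≡ xs! xs⊆ys z with z ∈? ys
  ... | no  z∉ys = count≡-off xs⊆ys z∉ys
  ... | yes z∈ys = ∑-squeeze ys count≤ (≤-reflexive (∑-count≡ xs⊆ys)) z∈ys
    where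
    count≤ : ∀ {u} → u ∈ ys → count u xs ≤ count u ys
    count≤ u∈ys = ≤-trans (Unique⇒count≤1 xs!) (≤-reflexive (sym (Unique⇒count≡1 ys! u∈ys)))

count≡⇒sameElements : ∀ {xs ys} → (∀ z → count z xs ≡ count z ys) → ∀ z → z ∈ xs ⇔ z ∈ ys
count≡⇒sameElements {xs} {ys} count≡ z =
  mk⇔ (λ z∈xs → count>0⇒∈ ys (≤-trans (∈⇒count>0 z∈xs) (≤-reflexive (count≡ z))))
      (λ z∈ys → count>0⇒∈ xs (≤-trans (∈⇒count>0 z∈ys) (≤-reflexive (sym (count≡ z)))))

Unique-map-weaken : ∀ {xs : List A} {f g : A → ℕ} → (∀ {x y} → g x ≡ g y → f x ≡ f y) →
  Unique (map f xs) → Unique (map g xs)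
Unique-map-weaken g≡⇒f≡ fxs! = AllPairs.map⁺ (AllPairs.map (λ fx≢fy → fx≢fy ∘ g≡⇒f≡) (AllPairs.map⁻ fxs!))

-- Arithmetic in ℤ_k

module _ (k′ : ℕ) where

  private
    k : ℕ
    k = suc k′

  [m%k+n]%k≡[m+n]%k : ∀ a b → (a % k + b) % k ≡ (a + b) % k
  [m%k+n]%k≡[m+n]%k a b = begin
    (a % k + b) % k          ≡⟨ %-distribˡ-+ (a % k) b k ⟩
    (a % k % k + b % k) % k  ≡⟨ cong (λ x → (x + b % k) % k) (m%n%n≡m%n a k) ⟩
    (a % k + b % k) % k      ≡⟨ %-distribˡ-+ a b k ⟨
    (a + b) % k              ∎
    where open ≡-Reasoning

  [m+n%k]%k≡[m+n]%k : ∀ a b → (a + b % k) % k ≡ (a + b) % k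
  [m+n%k]%k≡[m+n]%k a b = begin
    (a + b % k) % k  ≡⟨ cong (_% k) (+-comm a (b % k)) ⟩
    (b % k + a) % k  ≡⟨ [m%k+n]%k≡[m+n]%k b a ⟩
    (b + a) % k      ≡⟨ cong (_% k) (+-comm b a) ⟩
    (a + b) % k      ∎
    where open ≡-Reasoning

  +-congˡ-mod : ∀ c {u v} → u % k ≡ v % k → (c + u) % k ≡ (c + v) % k
  +-congˡ-mod c {u} {v} u≡v = begin
    (c + u) % k      ≡⟨ [m+n%k]%k≡[m+n]%k c u ⟨
    (c + u % k) % k  ≡⟨ cong (λ x → (c + x) % k) u≡v ⟩
    (c + v % k) % k  ≡⟨ [m+n%k]%k≡[m+n]%k c v ⟩
    (c + v) % k      ∎
    where open ≡-Reasoning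

  -- Adding c * k′ to c + u gives u + c * k, which is u modulo k.
  +-cancelˡ-mod : ∀ c {u v} → (c + u) % k ≡ (c + v) % k → u % k ≡ v % k
  +-cancelˡ-mod c {u} {v} c+u≡c+v = trans (undo u) (trans (cong (λ x → (x + c * k′) % k) c+u≡c+v) (sym (undo v)))
    where
    undo : ∀ w → w % k ≡ ((c + w) % k + c * k′) % k
    undo w = begin
      w % k                     ≡⟨ [m+kn]%n≡m%n w c k ⟨
      (w + c * k) % k           ≡⟨ cong (_% k) (solve 3 (λ w c k′ → w :+ c :* (con 1 :+ k′) := (c :+ w) :+ c :* k′) refl w c k′) ⟩
      ((c + w) + c * k′) % k    ≡⟨ [m%k+n]%k≡[m+n]%k (c + w) (c * k′) ⟨
      ((c + w) % k + c * k′) % k ∎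
      where open ≡-Reasoning

  neg< : ∀ a → neg k a < k
  neg< a = m%n<n (k ∸ a % k) k

  neg-inverseʳ : ∀ a → (a + neg k a) % k ≡ 0
  neg-inverseʳ a = begin
    (a + (k ∸ a % k) % k) % k  ≡⟨ [m+n%k]%k≡[m+n]%k a (k ∸ a % k) ⟩
    (a + (k ∸ a % k)) % k      ≡⟨ [m%k+n]%k≡[m+n]%k a (k ∸ a % k) ⟨
    (a % k + (k ∸ a % k)) % k  ≡⟨ cong (_% k) (m+[n∸m]≡n (m%n≤n a k)) ⟩
    k % k                      ≡⟨ n%n≡0 k ⟩
    0                          ∎
    where open ≡-Reasoning

  inverse-unique : ∀ w {u v} → u < k → v < k → (w + u) % k ≡ 0 → (w + v) % k ≡ 0 → u ≡ v
  inverse-unique w {u} {v} u<k v<k w+u≡0 w+v≡0 =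
    trans (sym (m<n⇒m%n≡m u<k)) (trans (+-cancelˡ-mod w (trans w+u≡0 (sym w+v≡0))) (m<n⇒m%n≡m v<k))

  neg-involutive : ∀ {a} → a < k → neg k (neg k a) ≡ a
  neg-involutive {a} a<k = inverse-unique (neg k a) (neg< (neg k a)) a<k
    (neg-inverseʳ (neg k a)) (trans (cong (_% k) (+-comm (neg k a) a)) (neg-inverseʳ a))

  neg-+ : ∀ r t → (neg k r + neg k t) % k ≡ neg k ((r + t) % k)
  neg-+ r t = inverse-unique (r + t) (m%n<n (neg k r + neg k t) k) (neg< ((r + t) % k)) sum-inverse
    (trans (sym ([m%k+n]%k≡[m+n]%k (r + t) (neg k ((r + t) % k)))) (neg-inverseʳ ((r + t) % k)))
    where
    sum-inverse : ((r + t) + (neg k r + neg k t) % k) % k ≡ 0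
    sum-inverse = begin
      ((r + t) + (neg k r + neg k t) % k) % k        ≡⟨ [m+n%k]%k≡[m+n]%k (r + t) _ ⟩
      ((r + t) + (neg k r + neg k t)) % k            ≡⟨ cong (_% k) (interchange r t (neg k r) (neg k t)) ⟩
      ((r + neg k r) + (t + neg k t)) % k            ≡⟨ %-distribˡ-+ (r + neg k r) (t + neg k t) k ⟩
      ((r + neg k r) % k + (t + neg k t) % k) % k    ≡⟨ cong₂ (λ x y → (x + y) % k) (neg-inverseʳ r) (neg-inverseʳ t) ⟩
      0                                              ∎
      where open ≡-Reasoning

  ∑-δ-neg : ∀ {a} xs {f : A → ℕ} → a < k → (∀ {x} → x ∈ xs → f x < k) →
    ∑ xs (λ x → δ (neg k (f x)) a) ≡ ∑ xs (λ x → δ (f x) (neg k a))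
  ∑-δ-neg {a = a} xs {f} a<k f<k = ∑-cong xs δ-neg
    where
    δ-neg : ∀ {x} → x ∈ xs → δ (neg k (f x)) a ≡ δ (f x) (neg k a)
    δ-neg {x} x∈xs with neg k (f x) ≟ a | f x ≟ neg k a
    ... | yes _    | yes _    = refl
    ... | no  _    | no  _    = refl
    ... | yes nx≡a | no  fx≢  = ⊥-elim (fx≢ (trans (sym (neg-involutive (f<k x∈xs))) (cong (neg k) nx≡a)))
    ... | no  nx≢a | yes fx≡  = ⊥-elim (nx≢a (trans (cong (neg k) fx≡) (neg-involutive a<k)))

-- Base-n digits of ℤ_nm

module _ (n′ m′ : ℕ) where

  private
    n m : ℕ
    n = suc n′
    m = suc m′

  digits : ∀ z → z ≡ n * (z / n) + z % n
  digits z = trans (m≡m%n+[m/n]*n z n) (trans (+-comm (z % n) _) (cong (_+ z % n) (*-comm (z / n) n)))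

  [n*a+b]%n≡b : ∀ a {b} → b < n → (n * a + b) % n ≡ b
  [n*a+b]%n≡b a {b} b<n = begin
    (n * a + b) % n  ≡⟨ cong (_% n) (trans (+-comm (n * a) b) (cong (b +_) (*-comm n a))) ⟩
    (b + a * n) % n  ≡⟨ [m+kn]%n≡m%n b a n ⟩
    b % n            ≡⟨ m<n⇒m%n≡m b<n ⟩
    b                ∎
    where open ≡-Reasoning

  digits-injective : ∀ {a a′ b b′} → b′ < n → b < n → n * a′ + b′ ≡ n * a + b → a′ ≡ a × b′ ≡ b
  digits-injective {a} {a′} {b} {b′} b′<n b<n eq = a′≡a , b′≡b
    where
    b′≡b : b′ ≡ b
    b′≡b = trans (sym ([n*a+b]%n≡b a′ b′<n)) (trans (cong (_% n) eq) ([n*a+b]%n≡b a b<n))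
    a′≡a : a′ ≡ a
    a′≡a = *-cancelˡ-≡ a′ a n (+-cancelʳ-≡ b _ _ (trans (cong (n * a′ +_) (sym b′≡b)) eq))

  δ-digits : ∀ a′ a {b′ b} → b′ < n → b < n → δ (n * a′ + b′) (n * a + b) ≡ δ a′ a * δ b′ b
  δ-digits a′ a {b′} {b} b′<n b<n with a′ ≟ a | b′ ≟ b
  ... | yes refl | yes refl = δ-refl _
  ... | yes refl | no  b′≢b = δ-≢ (λ eq → b′≢b (proj₂ (digits-injective b′<n b<n eq)))
  ... | no  a′≢a | _        = δ-≢ (λ eq → a′≢a (proj₁ (digits-injective b′<n b<n eq)))

  n*a+b<n*m : ∀ {a b} → a < m → b < n → n * a + b < n * m
  n*a+b<n*m {a} {b} a<m b<n = begin-strict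
    n * a + b  <⟨ +-monoʳ-< (n * a) b<n ⟩
    n * a + n  ≡⟨ trans (+-comm (n * a) n) (sym (*-suc n a)) ⟩
    n * suc a  ≤⟨ *-monoʳ-≤ n a<m ⟩
    n * m      ∎
    where open ≤-Reasoning

  -- Long addition: the low digit of u + v n is u mod n, and the carry u / n goes into the high digit.
  [u+v*n]%[n*m] : ∀ u v → (u + v * n) % (n * m) ≡ n * ((u / n + v) % m) + u % n
  [u+v*n]%[n*m] u v = begin
    w % (n * m)                              ≡⟨ m≡m%n+[m/n]*n (w % (n * m)) n ⟩
    w % (n * m) % n + (w % (n * m) / n) * n  ≡⟨ cong₂ _+_ low-digit (cong (_* n) high-digit) ⟩
    u % n + ((u / n + v) % m) * n            ≡⟨ trans (+-comm (u % n) _) (cong (_+ u % n) (*-comm _ n)) ⟩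
    n * ((u / n + v) % m) + u % n            ∎
    where
    open ≡-Reasoning
    w : ℕ
    w = u + v * n
    low-digit : w % (n * m) % n ≡ u % n
    low-digit = trans (m∣n⇒o%n%m≡o%m n (n * m) w (divides m (*-comm n m))) ([m+kn]%n≡m%n u v n)
    high-digit : w % (n * m) / n ≡ (u / n + v) % m
    high-digit = begin
      w % (n * m) / n  ≡⟨ /-congˡ (%-congʳ {o = w} (*-comm n m)) ⟩
      w % (m * n) / n  ≡⟨ m%[n*o]/o≡m/o%n w m n ⟩
      (w / n) % m      ≡⟨ %-congˡ (trans (+-distrib-/-∣ʳ u (divides-refl v)) (cong (u / n +_) (m*n/n≡m v n))) ⟩
      (u / n + v) % m  ∎

-- ℤ_k^*, pairs and 2-partitions

upTo≡0∷ZStar : ∀ k → upTo (suc k) ≡ 0 ∷ ZStar (suc k)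
upTo≡0∷ZStar k = cong (0 ∷_) (sym (map-upTo suc k))

ZStar-unique : ∀ k → Unique (ZStar k)
ZStar-unique k = Unique.map⁺ suc-injective (Unique.upTo⁺ (k ∸ 1))

∈-ZStar⁻ : ∀ {k z} → z ∈ ZStar (suc k) → 0 < z × z < suc k
∈-ZStar⁻ z∈ZStar with _ , z′∈upTo , refl ← ∈-map⁻ suc z∈ZStar = s≤s z≤n , s≤s (∈-upTo⁻ z′∈upTo)

length-ZStar : ∀ k → length (ZStar k) ≡ k ∸ 1
length-ZStar k = trans (length-map suc (upTo (k ∸ 1))) (length-upTo (k ∸ 1))

module _ {k : ℕ} where

  count-upTo-< : ∀ {z} → z < k → count z (upTo k) ≡ 1
  count-upTo-< z<k = Unique⇒count≡1 (Unique.upTo⁺ k) (∈-upTo⁺ z<k)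

  count-upTo-≥ : ∀ {z} → k ≤ z → count z (upTo k) ≡ 0
  count-upTo-≥ k≤z = ∉⇒count≡0 (upTo k) (λ z∈upTo → <⇒≱ (∈-upTo⁻ z∈upTo) k≤z)

count-upTo : ∀ k z → count z (upTo (suc k)) ≡ δ 0 z + count z (ZStar (suc k))
count-upTo k z = cong (count z) (upTo≡0∷ZStar k)

module _ (n′ m′ : ℕ) where

  private
    n m : ℕ
    n = suc n′
    m = suc m′

  count-upTo-digits : ∀ a {b} → b < n → count (n * a + b) (upTo (n * m)) ≡ count a (upTo m)
  count-upTo-digits a b<n with a <? m
  ... | yes a<m = trans (count-upTo-< (n*a+b<n*m n′ m′ a<m b<n)) (sym (count-upTo-< a<m))
  ... | no  a≮m = trans (count-upTo-≥ (≤-trans (*-monoʳ-≤ n (≮⇒≥ a≮m)) (m≤m+n (n * a) _)))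
                        (sym (count-upTo-≥ (≮⇒≥ a≮m)))

  -- ℤ_nm = ℤ_m × ℤ_n by digits, with 0 = (0 , 0) removed on both sides.
  count-ZStar-digits : ∀ a {b} → b < n →
    count (n * a + b) (ZStar (n * m)) ≡ count a (upTo m) * count b (ZStar n) + count a (ZStar m) * δ 0 b
  count-ZStar-digits a {b} b<n = +-cancelˡ-≡ (δ 0 a * δ 0 b) _ _ (begin
    δ 0 a * δ 0 b + count z (ZStar (n * m))       ≡⟨ cong (_+ count z (ZStar (n * m))) δ0-digits ⟨
    δ 0 z + count z (ZStar (n * m))               ≡⟨ count-upTo (m′ + n′ * m) z ⟨
    count z (upTo (n * m))                        ≡⟨ count-upTo-digits a b<n ⟩
    U a                                           ≡⟨ *-identityʳ (U a) ⟨
    U a * 1                                       ≡⟨ cong (U a *_) (trans (sym (count-upTo-< b<n)) (count-upTo n′ b)) ⟩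
    U a * (δ 0 b + Zn b)                          ≡⟨ *-distribˡ-+ (U a) (δ 0 b) (Zn b) ⟩
    U a * δ 0 b + U a * Zn b                      ≡⟨ cong (λ u → u * δ 0 b + U a * Zn b) (count-upTo m′ a) ⟩
    (δ 0 a + Zm a) * δ 0 b + U a * Zn b           ≡⟨ solve 4 (λ d₀ d e p → (d₀ :+ e) :* d :+ p := d₀ :* d :+ (p :+ e :* d)) refl (δ 0 a) (δ 0 b) (Zm a) (U a * Zn b) ⟩
    δ 0 a * δ 0 b + (U a * Zn b + Zm a * δ 0 b)   ∎)
    where
    open ≡-Reasoning
    z : ℕ
    z = n * a + b
    U Zn Zm : ℕ → ℕ
    U a = count a (upTo m)
    Zn b = count b (ZStar n)
    Zm a = count a (ZStar m)
    δ0-digits : δ 0 z ≡ δ 0 a * δ 0 b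
    δ0-digits = trans (cong (λ w → δ w z) (sym (trans (+-identityʳ (n * 0)) (*-zeroʳ n)))) (δ-digits n′ m′ 0 a (s≤s z≤n) b<n)

Bounded : ℕ → ℕ × ℕ → Set
Bounded k p = proj₁ p < k × proj₂ p < k

length-concatMap-pair : ∀ (f g : A → ℕ) xs → length (concatMap (λ x → f x ∷ g x ∷ []) xs) ≡ length xs + length xs
length-concatMap-pair f g []       = refl
length-concatMap-pair f g (x ∷ xs) = cong suc (trans (cong suc (length-concatMap-pair f g xs)) (sym (+-suc (length xs) _)))

count-concatMap-pair : ∀ (f g : A → ℕ) xs z →
  count z (concatMap (λ x → f x ∷ g x ∷ []) xs) ≡ ∑ xs (λ x → δ (f x) z + δ (g x) z)
count-concatMap-pair f g xs z =
  trans (∑-concatMap (λ x → f x ∷ g x ∷ []) xs (λ y → δ y z))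
        (∑-cong xs (λ {x} _ → cong (δ (f x) z +_) (+-identityʳ (δ (g x) z))))

entryCount : ℕ → ℕ × ℕ → ℕ
entryCount z p = δ (proj₁ p) z + δ (proj₂ p) z

count-entries : ∀ z P → count z (entries P) ≡ ∑ P (entryCount z)
count-entries z P = count-concatMap-pair proj₁ proj₂ P z

∈-pairs⇒∈-entries : ∀ {P : Pairs} {p} → p ∈ P → proj₁ p ∈ entries P × proj₂ p ∈ entries P
∈-pairs⇒∈-entries (here refl)  = here refl , there (here refl)
∈-pairs⇒∈-entries (there p∈P) with x∈ , y∈ ← ∈-pairs⇒∈-entries p∈P = there (there x∈) , there (there y∈)

∈-partition⇒< : ∀ {k P p} → IsTwoPartition (suc k) P → p ∈ P → Bounded (suc k) p
∈-partition⇒< part p∈P with x∈ , y∈ ← ∈-pairs⇒∈-entries p∈P =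
  proj₂ (∈-ZStar⁻ (∈-resp-↭ part x∈)) , proj₂ (∈-ZStar⁻ (∈-resp-↭ part y∈))

length-partition : ∀ k P → IsTwoPartition k P → length P + length P ≡ k ∸ 1
length-partition k P part = begin
  length P + length P   ≡⟨ length-concatMap-pair proj₁ proj₂ P ⟨
  length (entries P)    ≡⟨ ↭-length part ⟩
  length (ZStar k)      ≡⟨ length-ZStar k ⟩
  k ∸ 1                 ∎
  where open ≡-Reasoning

entries-ordering : ∀ {P Q} → IsOrdering P Q → entries P ↭ entries Q
entries-ordering []                = ↭.refl
entries-ordering (inj₁ refl ∷ P~Q) = ↭.prep _ (↭.prep _ (entries-ordering P~Q))
entries-ordering (inj₂ refl ∷ P~Q) = ↭.swap _ _ (entries-ordering P~Q)

partition-ordering : ∀ k {P Q} → IsOrdering P Q → IsTwoPartition k P → IsTwoPartition k Q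
partition-ordering k P~Q part = ↭-trans (↭-sym (entries-ordering P~Q)) part

sums-ordering : ∀ k {P Q} → IsOrdering P Q → sums k P ≡ sums k Q
sums-ordering k []                     = refl
sums-ordering k (inj₁ refl ∷ P~Q)      = cong (_ ∷_) (sums-ordering k P~Q)
sums-ordering k (_∷_ {x , y} (inj₂ refl) P~Q) = cong₂ _∷_ (cong (λ s → md s k) (+-comm x y)) (sums-ordering k P~Q)

Strong-ordering : ∀ {k P Q} → IsOrdering P Q → Strong k P ⇔ Strong k Q
Strong-ordering {k} P~Q = mk⇔ (subst StrongSums (sums-ordering k P~Q)) (subst StrongSums (sym (sums-ordering k P~Q)))
  where
  StrongSums : List ℕ → Set
  StrongSums ss = All (λ s → s ≢ 0) ss × Unique ss

Skew-ordering : ∀ {k P Q} → IsOrdering P Q → Skew k P ⇔ Skew k Q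
Skew-ordering {k} P~Q = mk⇔ (subst SkewSums (sums-ordering k P~Q)) (subst SkewSums (sym (sums-ordering k P~Q)))
  where
  SkewSums : List ℕ → Set
  SkewSums ss = ∀ z → (z ∈ concatMap (λ s → s ∷ neg k s ∷ []) ss) ⇔ (z ∈ ZStar k)

partition-nonempty : ∀ {k} P → IsTwoPartition (suc (suc k)) P → ∃ (_∈ P)
partition-nonempty []      part = ⊥-elim (0≢1+n (↭-length part))
partition-nonempty (p ∷ _) _    = p , here refl

-- The product W_ST

module Product (n′ m′ : ℕ) (St Tb : Pairs)
  (St-part : IsTwoPartition (suc n′) St) (Tb-part : IsTwoPartition (suc m′) Tb) where

  n m N : ℕ
  n = suc n′
  m = suc m′
  N = n * m

  negPair : ℕ × ℕ → ℕ × ℕ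
  negPair p = neg m (proj₁ p) , neg m (proj₂ p)

  R : Pairs
  R = Tb ++ barNeg m Tb ++ (0 , 0) ∷ []

  cell : ℕ × ℕ → ℕ × ℕ → ℕ × ℕ
  cell rt xy = md (n * proj₁ rt + proj₁ xy) N , md (n * proj₂ rt + proj₂ xy) N

  typeI typeII W : Pairs
  typeI  = concatMap (λ rt → map (cell rt) St) R
  typeII = map (λ rt → md (n * proj₁ rt) N , md (n * proj₂ rt) N) Tb
  W      = product n m St Tb

  ∑-R : ∀ (g : ℕ × ℕ → ℕ) → ∑ R g ≡ ∑ Tb g + ∑ Tb (g ∘ negPair) + g (0 , 0)
  ∑-R g = begin
    ∑ R g                                                  ≡⟨ ∑-++ Tb _ g ⟩
    ∑ Tb g + ∑ (barNeg m Tb ++ (0 , 0) ∷ []) g             ≡⟨ cong (∑ Tb g +_) (∑-++ (barNeg m Tb) _ g) ⟩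
    ∑ Tb g + (∑ (barNeg m Tb) g + (g (0 , 0) + 0))         ≡⟨ cong₂ (λ u v → ∑ Tb g + (u + v)) (∑-map negPair Tb g) (+-identityʳ _) ⟩
    ∑ Tb g + (∑ Tb (g ∘ negPair) + g (0 , 0))              ≡⟨ +-assoc (∑ Tb g) _ _ ⟨
    ∑ Tb g + ∑ Tb (g ∘ negPair) + g (0 , 0)                ∎
    where open ≡-Reasoning

  St< : ∀ {xy} → xy ∈ St → Bounded n xy
  St< = ∈-partition⇒< St-part

  Tb< : ∀ {rt} → rt ∈ Tb → Bounded m rt
  Tb< = ∈-partition⇒< Tb-part

  R< : ∀ {rt} → rt ∈ R → Bounded m rt
  R< rt∈R with ∈-++⁻ Tb rt∈R
  ... | inj₁ rt∈Tb = Tb< rt∈Tb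
  ... | inj₂ rt∈rest with ∈-++⁻ (barNeg m Tb) rt∈rest
  ...   | inj₁ rt∈barNeg with (r , t) , _ , refl ← ∈-map⁻ negPair rt∈barNeg = neg< m′ r , neg< m′ t
  ...   | inj₂ (here refl) = s≤s z≤n , s≤s z≤n

  length-R : length R ≡ m
  length-R = begin
    length R                                          ≡⟨ length-++ Tb ⟩
    length Tb + length (barNeg m Tb ++ (0 , 0) ∷ [])  ≡⟨ cong (length Tb +_) (length-++ (barNeg m Tb)) ⟩
    length Tb + (length (barNeg m Tb) + 1)            ≡⟨ cong (λ l → length Tb + (l + 1)) (length-map negPair Tb) ⟩
    length Tb + (length Tb + 1)                       ≡⟨ solve 1 (λ l → l :+ (l :+ con 1) := con 1 :+ (l :+ l)) refl (length Tb) ⟩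
    suc (length Tb + length Tb)                       ≡⟨ cong suc (length-partition m Tb Tb-part) ⟩
    m                                                 ∎
    where open ≡-Reasoning

  cell-digits : ∀ {rt xy} → Bounded m rt → Bounded n xy →
    cell rt xy ≡ (n * proj₁ rt + proj₁ xy , n * proj₂ rt + proj₂ xy)
  cell-digits (r<m , t<m) (x<n , y<n) =
    cong₂ _,_ (m<n⇒m%n≡m (n*a+b<n*m n′ m′ r<m x<n)) (m<n⇒m%n≡m (n*a+b<n*m n′ m′ t<m y<n))

  -- A type (ii) pair is the cell of (r , t) and (0 , 0).
  ∑-W : ∀ (g : ℕ × ℕ → ℕ) →
    ∑ W g ≡ ∑ R (λ rt → ∑ St (λ xy → g (cell rt xy))) + ∑ Tb (λ rt → g (cell rt (0 , 0)))
  ∑-W g = begin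
    ∑ (typeI ++ typeII) g                                                       ≡⟨ ∑-++ typeI typeII g ⟩
    ∑ typeI g + ∑ typeII g                                                      ≡⟨ cong₂ _+_ ∑-typeI ∑-typeII ⟩
    ∑ R (λ rt → ∑ St (λ xy → g (cell rt xy))) + ∑ Tb (λ rt → g (cell rt (0 , 0))) ∎
    where
    open ≡-Reasoning
    ∑-typeI : ∑ typeI g ≡ ∑ R (λ rt → ∑ St (λ xy → g (cell rt xy)))
    ∑-typeI = trans (∑-concatMap (λ rt → map (cell rt) St) R g) (∑-cong R (λ {rt} _ → ∑-map (cell rt) St g))
    ∑-typeII : ∑ typeII g ≡ ∑ Tb (λ rt → g (cell rt (0 , 0)))
    ∑-typeII = trans (∑-map _ Tb g)
      (∑-cong Tb (λ {rt} _ → cong g (sym (cong₂ _,_ (cong (λ u → md u N) (+-identityʳ (n * proj₁ rt)))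
                                                    (cong (λ u → md u N) (+-identityʳ (n * proj₂ rt)))))))

  count-entries-W : ∀ a {b} → b < n → count (n * a + b) (entries W) ≡
      ∑ R (λ rt → δ (proj₁ rt) a) * ∑ St (λ xy → δ (proj₁ xy) b)
    + ∑ R (λ rt → δ (proj₂ rt) a) * ∑ St (λ xy → δ (proj₂ xy) b)
    + ∑ Tb (entryCount a) * δ 0 b
  count-entries-W a {b} b<n = begin
    count z (entries W)                                                               ≡⟨ count-entries z W ⟩
    ∑ W (entryCount z)                                                                ≡⟨ ∑-W (entryCount z) ⟩
    ∑ R (λ rt → ∑ St (λ xy → entryCount z (cell rt xy)))
      + ∑ Tb (λ rt → entryCount z (cell rt (0 , 0)))                                  ≡⟨ cong₂ _+_ typeI-part typeII-part ⟩
    ∑ R (λ rt → δ (proj₁ rt) a) * ∑ St (λ xy → δ (proj₁ xy) b)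
      + ∑ R (λ rt → δ (proj₂ rt) a) * ∑ St (λ xy → δ (proj₂ xy) b)
      + ∑ Tb (entryCount a) * δ 0 b                                                   ∎
    where
    open ≡-Reasoning
    z : ℕ
    z = n * a + b
    entryCount-cell : ∀ {rt xy} → Bounded m rt → Bounded n xy →
      entryCount z (cell rt xy) ≡ δ (proj₁ rt) a * δ (proj₁ xy) b + δ (proj₂ rt) a * δ (proj₂ xy) b
    entryCount-cell {rt} rt< xy<@(x<n , y<n) = trans (cong (entryCount z) (cell-digits rt< xy<))
      (cong₂ _+_ (δ-digits n′ m′ (proj₁ rt) a x<n b<n) (δ-digits n′ m′ (proj₂ rt) a y<n b<n))
    typeI-part : ∑ R (λ rt → ∑ St (λ xy → entryCount z (cell rt xy))) ≡
      ∑ R (λ rt → δ (proj₁ rt) a) * ∑ St (λ xy → δ (proj₁ xy) b) + ∑ R (λ rt → δ (proj₂ rt) a) * ∑ St (λ xy → δ (proj₂ xy) b)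
    typeI-part = begin
      ∑ R (λ rt → ∑ St (λ xy → entryCount z (cell rt xy)))
        ≡⟨ ∑-cong R (λ rt∈R → trans (∑-cong St (λ xy∈St → entryCount-cell (R< rt∈R) (St< xy∈St))) (∑-+ St _ _)) ⟩
      ∑ R (λ rt → ∑ St (λ xy → δ (proj₁ rt) a * δ (proj₁ xy) b) + ∑ St (λ xy → δ (proj₂ rt) a * δ (proj₂ xy) b))
        ≡⟨ ∑-+ R _ _ ⟩
      _ ≡⟨ cong₂ _+_ (∑-product R St _ _) (∑-product R St _ _) ⟩
      _ ∎
    typeII-part : ∑ Tb (λ rt → entryCount z (cell rt (0 , 0))) ≡ ∑ Tb (entryCount a) * δ 0 b
    typeII-part = trans (∑-cong Tb (λ {rt} rt∈Tb → trans (entryCount-cell (Tb< rt∈Tb) (s≤s z≤n , s≤s z≤n))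
                                                         (sym (*-distribʳ-+ (δ 0 b) (δ (proj₁ rt) a) _))))
                        (∑-*ʳ Tb (δ 0 b) (entryCount a))

  count-entries-Tb : ∀ a → ∑ Tb (entryCount a) ≡ count a (ZStar m)
  count-entries-Tb a = trans (sym (count-entries a Tb)) (↭⇒count≡ Tb-part)

  count-entries-St : ∀ b → ∑ St (λ xy → δ (proj₁ xy) b) + ∑ St (λ xy → δ (proj₂ xy) b) ≡ count b (ZStar n)
  count-entries-St b = trans (sym (∑-+ St _ _)) (trans (sym (count-entries b St)) (↭⇒count≡ St-part))

  module Coordinates (bar : ∀ z → (z ∈ concatMap (λ p → proj₁ p ∷ neg m (proj₁ p) ∷ []) Tb) ⇔ (z ∈ ZStar m)) where

    X Y Z V : ℕ → ℕ
    X a = ∑ Tb (λ rt → δ (proj₁ rt) a)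
    Y a = ∑ Tb (λ rt → δ (neg m (proj₁ rt)) a)
    Z a = ∑ Tb (λ rt → δ (proj₂ rt) a)
    V a = ∑ Tb (λ rt → δ (neg m (proj₂ rt)) a)

    X+Y : ∀ a → X a + Y a ≡ count a (ZStar m)
    X+Y a = begin
      X a + Y a                                           ≡⟨ ∑-+ Tb _ _ ⟨
      ∑ Tb (λ rt → δ (proj₁ rt) a + δ (neg m (proj₁ rt)) a) ≡⟨ count-concatMap-pair proj₁ (neg m ∘ proj₁) Tb a ⟨
      count a barList                                     ≡⟨ sameElements⇒count≡ (ZStar-unique m) length-barList bar a ⟩
      count a (ZStar m)                                   ∎
      where
      open ≡-Reasoning
      barList : List ℕ
      barList = concatMap (λ p → proj₁ p ∷ neg m (proj₁ p) ∷ []) Tb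
      length-barList : length barList ≡ length (ZStar m)
      length-barList = trans (length-concatMap-pair proj₁ (neg m ∘ proj₁) Tb)
                             (trans (length-partition m Tb Tb-part) (sym (length-ZStar m)))

    X+Z : ∀ a → X a + Z a ≡ count a (ZStar m)
    X+Z a = trans (sym (∑-+ Tb _ _)) (count-entries-Tb a)

    Z≡Y : ∀ a → Z a ≡ Y a
    Z≡Y a = +-cancelˡ-≡ (X a) _ _ (trans (X+Z a) (sym (X+Y a)))

    -- Z ≡ Y says the second coordinates of T̄ are the negated first ones; negating again gives V ≡ X.
    V≡X : ∀ a → V a ≡ X a
    V≡X a with a <? m
    ... | yes a<m = begin
      V a             ≡⟨ ∑-δ-neg m′ Tb a<m (proj₂ ∘ Tb<) ⟩
      Z (neg m a)     ≡⟨ Z≡Y (neg m a) ⟩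
      Y (neg m a)     ≡⟨ ∑-δ-neg m′ Tb (neg< m′ a) (proj₁ ∘ Tb<) ⟩
      ∑ Tb (λ rt → δ (proj₁ rt) (neg m (neg m a))) ≡⟨ cong (λ c → ∑ Tb (λ rt → δ (proj₁ rt) c)) (neg-involutive m′ a<m) ⟩
      X a             ∎
      where open ≡-Reasoning
    ... | no a≮m = trans (∑-δ-≥ Tb (λ {rt} _ → neg< m′ (proj₂ rt)) (≮⇒≥ a≮m))
                         (sym (∑-δ-≥ Tb (proj₁ ∘ Tb<) (≮⇒≥ a≮m)))

    count-proj₁-R : ∀ a → ∑ R (λ rt → δ (proj₁ rt) a) ≡ count a (upTo m)
    count-proj₁-R a = begin
      ∑ R (λ rt → δ (proj₁ rt) a)   ≡⟨ ∑-R (λ rt → δ (proj₁ rt) a) ⟩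
      X a + Y a + δ 0 a             ≡⟨ cong (_+ δ 0 a) (X+Y a) ⟩
      count a (ZStar m) + δ 0 a     ≡⟨ +-comm _ (δ 0 a) ⟩
      δ 0 a + count a (ZStar m)     ≡⟨ count-upTo m′ a ⟨
      count a (upTo m)              ∎
      where open ≡-Reasoning

    count-proj₂-R : ∀ a → ∑ R (λ rt → δ (proj₂ rt) a) ≡ count a (upTo m)
    count-proj₂-R a = begin
      ∑ R (λ rt → δ (proj₂ rt) a)   ≡⟨ ∑-R (λ rt → δ (proj₂ rt) a) ⟩
      Z a + V a + δ 0 a             ≡⟨ cong₂ (λ u v → u + v + δ 0 a) (Z≡Y a) (V≡X a) ⟩
      Y a + X a + δ 0 a             ≡⟨ cong (_+ δ 0 a) (+-comm (Y a) (X a)) ⟩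
      X a + Y a + δ 0 a             ≡⟨ ∑-R (λ rt → δ (proj₁ rt) a) ⟨
      ∑ R (λ rt → δ (proj₁ rt) a)   ≡⟨ count-proj₁-R a ⟩
      count a (upTo m)              ∎
      where open ≡-Reasoning

    W-partition : IsTwoPartition N W
    W-partition = count≡⇒↭ (entries W) (ZStar N) (λ z →
      subst (λ z → count z (entries W) ≡ count z (ZStar N)) (sym (digits n′ m′ z)) (at-digits (z / n) (m%n<n z n)))
      where
      at-digits : ∀ a {b} → b < n → count (n * a + b) (entries W) ≡ count (n * a + b) (ZStar N)
      at-digits a {b} b<n = begin
        count (n * a + b) (entries W)                                  ≡⟨ count-entries-W a b<n ⟩
        ∑ R (λ rt → δ (proj₁ rt) a) * ∑ St (λ xy → δ (proj₁ xy) b)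
          + ∑ R (λ rt → δ (proj₂ rt) a) * ∑ St (λ xy → δ (proj₂ xy) b)
          + ∑ Tb (entryCount a) * δ 0 b                                 ≡⟨ cong₂ (λ u v → u * _ + v * _ + _) (count-proj₁-R a) (count-proj₂-R a) ⟩
        count a (upTo m) * ∑ St (λ xy → δ (proj₁ xy) b)
          + count a (upTo m) * ∑ St (λ xy → δ (proj₂ xy) b)
          + ∑ Tb (entryCount a) * δ 0 b                                 ≡⟨ cong₂ _+_ (sym (*-distribˡ-+ (count a (upTo m)) _ _)) (cong (_* δ 0 b) (count-entries-Tb a)) ⟩
        count a (upTo m) * (∑ St (λ xy → δ (proj₁ xy) b) + ∑ St (λ xy → δ (proj₂ xy) b))
          + count a (ZStar m) * δ 0 b                                   ≡⟨ cong (λ u → count a (upTo m) * u + _) (count-entries-St b) ⟩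
        count a (upTo m) * count b (ZStar n) + count a (ZStar m) * δ 0 b ≡⟨ count-ZStar-digits n′ m′ a b<n ⟨
        count (n * a + b) (ZStar N)                                    ∎
        where open ≡-Reasoning

  carry low : ℕ × ℕ → ℕ
  carry xy = (proj₁ xy + proj₂ xy) / n
  low   xy = (proj₁ xy + proj₂ xy) % n

  rsum : ℕ → ℕ × ℕ → ℕ
  rsum c rt = (c + (proj₁ rt + proj₂ rt)) % m

  rsums : ℕ → List ℕ
  rsums c = map (rsum c) R

  pairSum : ℕ → ℕ × ℕ → ℕ
  pairSum k p = md (proj₁ p + proj₂ p) k

  pairSum-cell : ∀ {rt xy} → Bounded m rt → Bounded n xy → pairSum N (cell rt xy) ≡ n * rsum (carry xy) rt + low xy
  pairSum-cell {r , t} {x , y} rt< xy< = begin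
    pairSum N (cell (r , t) (x , y))   ≡⟨ cong (pairSum N) (cell-digits rt< xy<) ⟩
    ((n * r + x) + (n * t + y)) % N    ≡⟨ cong (_% N) (solve 5 (λ n r x t y → (n :* r :+ x) :+ (n :* t :+ y) := (x :+ y) :+ (r :+ t) :* n) refl n r x t y) ⟩
    ((x + y) + (r + t) * n) % N        ≡⟨ [u+v*n]%[n*m] n′ m′ (x + y) (r + t) ⟩
    n * rsum (carry (x , y)) (r , t) + low (x , y) ∎
    where open ≡-Reasoning

  count-sums-W : ∀ a {b} → b < n → count (n * a + b) (sums N W) ≡
    ∑ St (λ xy → count a (rsums (carry xy)) * δ (low xy) b) + count a (sums m Tb) * δ 0 b
  count-sums-W a {b} b<n = begin
    count z (sums N W)                                                        ≡⟨ ∑-map (pairSum N) W (λ s → δ s z) ⟩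
    ∑ W (λ p → δ (pairSum N p) z)                                             ≡⟨ ∑-W (λ p → δ (pairSum N p) z) ⟩
    ∑ R (λ rt → ∑ St (λ xy → δ (pairSum N (cell rt xy)) z))
      + ∑ Tb (λ rt → δ (pairSum N (cell rt (0 , 0))) z)                       ≡⟨ cong₂ _+_ typeI-part typeII-part ⟩
    ∑ St (λ xy → count a (rsums (carry xy)) * δ (low xy) b) + count a (sums m Tb) * δ 0 b ∎
    where
    open ≡-Reasoning
    z : ℕ
    z = n * a + b
    δ-cell : ∀ {rt xy} → Bounded m rt → Bounded n xy → δ (pairSum N (cell rt xy)) z ≡ δ (rsum (carry xy) rt) a * δ (low xy) b
    δ-cell {rt} {xy} rt< xy< = trans (cong (λ s → δ s z) (pairSum-cell rt< xy<))
                                     (δ-digits n′ m′ (rsum (carry xy) rt) a (m%n<n (proj₁ xy + proj₂ xy) n) b<n)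
    typeI-part : ∑ R (λ rt → ∑ St (λ xy → δ (pairSum N (cell rt xy)) z)) ≡ ∑ St (λ xy → count a (rsums (carry xy)) * δ (low xy) b)
    typeI-part = begin
      ∑ R (λ rt → ∑ St (λ xy → δ (pairSum N (cell rt xy)) z))
        ≡⟨ ∑-cong R (λ rt∈R → ∑-cong St (λ xy∈St → δ-cell (R< rt∈R) (St< xy∈St))) ⟩
      ∑ R (λ rt → ∑ St (λ xy → δ (rsum (carry xy) rt) a * δ (low xy) b))
        ≡⟨ ∑-comm R St _ ⟩
      ∑ St (λ xy → ∑ R (λ rt → δ (rsum (carry xy) rt) a * δ (low xy) b))
        ≡⟨ ∑-cong St (λ {xy} _ → trans (∑-*ʳ R (δ (low xy) b) _) (cong (_* δ (low xy) b) (sym (∑-map (rsum (carry xy)) R _)))) ⟩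
      ∑ St (λ xy → count a (rsums (carry xy)) * δ (low xy) b) ∎
    typeII-part : ∑ Tb (λ rt → δ (pairSum N (cell rt (0 , 0))) z) ≡ count a (sums m Tb) * δ 0 b
    typeII-part = begin
      ∑ Tb (λ rt → δ (pairSum N (cell rt (0 , 0))) z)  ≡⟨ ∑-cong Tb (λ rt∈Tb → δ-cell (Tb< rt∈Tb) (s≤s z≤n , s≤s z≤n)) ⟩
      ∑ Tb (λ rt → δ (rsum 0 rt) a * δ 0 b)            ≡⟨ ∑-*ʳ Tb (δ 0 b) _ ⟩
      ∑ Tb (λ rt → δ (rsum 0 rt) a) * δ 0 b            ≡⟨ cong (_* δ 0 b) (∑-map (rsum 0) Tb (λ s → δ s a)) ⟨
      count a (sums m Tb) * δ 0 b                      ∎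

  rsums⊆upTo : ∀ c → rsums c ⊆ upTo m
  rsums⊆upTo c s∈rsums with rt , _ , refl ← ∈-map⁻ (rsum c) s∈rsums = ∈-upTo⁺ (m%n<n (c + (proj₁ rt + proj₂ rt)) m)

  length-rsums : ∀ c → length (rsums c) ≡ m
  length-rsums c = trans (length-map (rsum c) R) length-R

  ∑-count-rsums : ∀ c → ∑ (upTo m) (λ a → count a (rsums c)) ≡ m
  ∑-count-rsums c = trans (∑-count (Unique.upTo⁺ m) (rsums⊆upTo c)) (length-rsums c)

  -- Adding the carry is a bijection of ℤ_m, so distinctness of the sums does not depend on it.
  rsums-unique-shift : ∀ c d → Unique (rsums c) → Unique (rsums d)
  rsums-unique-shift c d = Unique-map-weaken (λ eq → +-congˡ-mod m′ c (+-cancelˡ-mod m′ d eq))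

  skewList : List ℕ
  skewList = concatMap (λ s → s ∷ neg m s ∷ []) (sums m Tb)

  count-rsums0 : ∀ a → count a (rsums 0) ≡ count a skewList + δ 0 a
  count-rsums0 a = begin
    count a (rsums 0)                                                          ≡⟨ ∑-map (rsum 0) R (λ s → δ s a) ⟩
    ∑ R (λ rt → δ (rsum 0 rt) a)                                                ≡⟨ ∑-R _ ⟩
    ∑ Tb (λ rt → δ (rsum 0 rt) a) + ∑ Tb (λ rt → δ (rsum 0 (negPair rt)) a) + δ 0 a
      ≡⟨ cong (λ u → ∑ Tb (λ rt → δ (rsum 0 rt) a) + u + δ 0 a)
              (∑-cong Tb (λ {rt} _ → cong (λ s → δ s a) (neg-+ m′ (proj₁ rt) (proj₂ rt)))) ⟩
    ∑ Tb (λ rt → δ (rsum 0 rt) a) + ∑ Tb (λ rt → δ (neg m (rsum 0 rt)) a) + δ 0 a ≡⟨ cong (_+ δ 0 a) (∑-+ Tb _ _) ⟨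
    ∑ Tb (λ rt → δ (rsum 0 rt) a + δ (neg m (rsum 0 rt)) a) + δ 0 a            ≡⟨ cong (_+ δ 0 a) (∑-map (rsum 0) Tb _) ⟨
    ∑ (sums m Tb) (λ s → δ s a + δ (neg m s) a) + δ 0 a                          ≡⟨ cong (_+ δ 0 a) (count-concatMap-pair id (neg m) (sums m Tb) a) ⟨
    count a skewList + δ 0 a                                                   ∎
    where open ≡-Reasoning

  Skew⇔rsums-unique : Skew m Tb ⇔ Unique (rsums 0)
  Skew⇔rsums-unique = mk⇔ to from
    where
    length-skewList : length skewList ≡ length (ZStar m)
    length-skewList = begin
      length skewList                    ≡⟨ length-concatMap-pair id (neg m) (sums m Tb) ⟩
      length (sums m Tb) + length (sums m Tb) ≡⟨ cong (λ l → l + l) (length-map _ Tb) ⟩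
      length Tb + length Tb              ≡⟨ length-partition m Tb Tb-part ⟩
      m′                                 ≡⟨ length-ZStar m ⟨
      length (ZStar m)                   ∎
      where open ≡-Reasoning
    count-rsums0≡count-upTo : ∀ a → count a skewList ≡ count a (ZStar m) → count a (rsums 0) ≡ count a (upTo m)
    count-rsums0≡count-upTo a eq = trans (count-rsums0 a) (trans (cong (_+ δ 0 a) eq) (trans (+-comm _ (δ 0 a)) (sym (count-upTo m′ a))))
    to : Skew m Tb → Unique (rsums 0)
    to skew = count≤1⇒Unique (rsums 0) (λ a → ≤-trans
      (≤-reflexive (count-rsums0≡count-upTo a (sameElements⇒count≡ (ZStar-unique m) length-skewList skew a)))
      (Unique⇒count≤1 (Unique.upTo⁺ m)))
    from : Unique (rsums 0) → Skew m Tb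
    from rsums! = count≡⇒sameElements (λ a → +-cancelʳ-≡ (δ 0 a) _ _ (begin
      count a skewList + δ 0 a   ≡⟨ count-rsums0 a ⟨
      count a (rsums 0)          ≡⟨ Unique⊆⇒count≡ (Unique.upTo⁺ m) (trans (length-rsums 0) (sym (length-upTo m))) rsums! (rsums⊆upTo 0) a ⟩
      count a (upTo m)           ≡⟨ count-upTo m′ a ⟩
      δ 0 a + count a (ZStar m)  ≡⟨ +-comm (δ 0 a) _ ⟩
      count a (ZStar m) + δ 0 a  ∎))
      where open ≡-Reasoning

  typeI-count≤ : ∀ a {b} → b < n → ∑ St (λ xy → count a (rsums (carry xy)) * δ (low xy) b) ≤ count (n * a + b) (sums N W)
  typeI-count≤ a b<n = ≤-trans (m≤m+n _ _) (≤-reflexive (sym (count-sums-W a b<n)))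

  -- Each sum x + y ≡ b (mod n) of S̃ produces one sum of W_ST in every class n a + b with a ∈ ℤ_m.
  m*count≤ : ∀ {b} → b < n → m * count b (sums n St) ≤ ∑ (upTo m) (λ a → count (n * a + b) (sums N W))
  m*count≤ {b} b<n = begin
    m * count b (sums n St)                                            ≡⟨ cong (m *_) (∑-map (pairSum n) St (λ s → δ s b)) ⟩
    m * ∑ St (λ xy → δ (low xy) b)                                     ≡⟨ ∑-*ˡ St m (λ xy → δ (low xy) b) ⟨
    ∑ St (λ xy → m * δ (low xy) b)                                     ≡⟨ ∑-cong St (λ {xy} _ → cong (_* δ (low xy) b) (sym (∑-count-rsums (carry xy)))) ⟩
    ∑ St (λ xy → ∑ (upTo m) (λ a → count a (rsums (carry xy))) * δ (low xy) b)
                                                                      ≡⟨ ∑-cong St (λ {xy} _ → sym (∑-*ʳ (upTo m) (δ (low xy) b) (λ a → count a (rsums (carry xy))))) ⟩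
    ∑ St (λ xy → ∑ (upTo m) (λ a → count a (rsums (carry xy)) * δ (low xy) b)) ≡⟨ ∑-comm St (upTo m) _ ⟩
    ∑ (upTo m) (λ a → ∑ St (λ xy → count a (rsums (carry xy)) * δ (low xy) b)) ≤⟨ ∑-mono (upTo m) (λ {a} _ → typeI-count≤ a b<n) ⟩
    ∑ (upTo m) (λ a → count (n * a + b) (sums N W))                    ∎
    where open ≤-Reasoning

  count-sums-St-≥ : ∀ {b} → n ≤ b → count b (sums n St) ≡ 0
  count-sums-St-≥ n≤b = trans (∑-map _ St _) (∑-δ-≥ St (λ {xy} _ → m%n<n (proj₁ xy + proj₂ xy) n) n≤b)

  W-unique⇒St-unique : Unique (sums N W) → Unique (sums n St)
  W-unique⇒St-unique W! = count≤1⇒Unique (sums n St) count≤1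
    where
    count≤1 : ∀ b → count b (sums n St) ≤ 1
    count≤1 b with b <? n
    ... | no  b≮n = ≤-trans (≤-reflexive (count-sums-St-≥ (≮⇒≥ b≮n))) z≤n
    ... | yes b<n = *-cancelˡ-≤ m (begin
      m * count b (sums n St)                           ≤⟨ m*count≤ b<n ⟩
      ∑ (upTo m) (λ a → count (n * a + b) (sums N W))   ≤⟨ ∑-≤-length (upTo m) (λ _ → Unique⇒count≤1 W!) ⟩
      length (upTo m)                                   ≡⟨ length-upTo m ⟩
      m                                                 ≡⟨ *-identityʳ m ⟨
      m * 1                                             ∎)
      where open ≤-Reasoning

  W-strong⇒St-nonzero : Strong N W → All (_≢ 0) (sums n St)
  W-strong⇒St-nonzero (W≢0 , W!) = count≡0⇒All≢ (sums n St) (n<1⇒n≡0 (*-cancelˡ-< m _ _ (begin-strict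
    m * count 0 (sums n St)                                  ≤⟨ m*count≤ (s≤s z≤n) ⟩
    ∑ (upTo m) (λ a → count (n * a + 0) (sums N W))          ≡⟨ cong (λ l → ∑ l (λ a → count (n * a + 0) (sums N W))) (upTo≡0∷ZStar m′) ⟩
    count (n * 0 + 0) (sums N W)
      + ∑ (ZStar m) (λ a → count (n * a + 0) (sums N W))     ≡⟨ cong (_+ ∑ (ZStar m) (λ a → count (n * a + 0) (sums N W))) count-0 ⟩
    ∑ (ZStar m) (λ a → count (n * a + 0) (sums N W))         ≤⟨ ∑-≤-length (ZStar m) (λ _ → Unique⇒count≤1 W!) ⟩
    length (ZStar m)                                         ≡⟨ length-ZStar m ⟩
    m′                                                       <⟨ n<1+n m′ ⟩
    m                                                        ≡⟨ *-identityʳ m ⟨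
    m * 1                                                    ∎)))
    where
    open ≤-Reasoning
    count-0 : count (n * 0 + 0) (sums N W) ≡ 0
    count-0 = trans (cong (λ z → count z (sums N W)) (trans (+-identityʳ (n * 0)) (*-zeroʳ n))) (All≢⇒count≡0 W≢0)

  W-unique⇒rsums-unique : ∀ {xy₀} → xy₀ ∈ St → Unique (sums N W) → Unique (rsums 0)
  W-unique⇒rsums-unique {xy₀} xy₀∈St W! = rsums-unique-shift (carry xy₀) 0 (count≤1⇒Unique (rsums (carry xy₀)) (λ a → begin
    count a (rsums (carry xy₀))                                             ≡⟨ *-identityʳ _ ⟨
    count a (rsums (carry xy₀)) * 1                                         ≡⟨ cong (count a (rsums (carry xy₀)) *_) (δ-refl (low xy₀)) ⟨
    count a (rsums (carry xy₀)) * δ (low xy₀) (low xy₀)                     ≤⟨ ∑-∈ (λ xy → count a (rsums (carry xy)) * δ (low xy) (low xy₀)) xy₀∈St ⟩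
    ∑ St (λ xy → count a (rsums (carry xy)) * δ (low xy) (low xy₀))         ≤⟨ typeI-count≤ a (m%n<n (proj₁ xy₀ + proj₂ xy₀) n) ⟩
    count (n * a + low xy₀) (sums N W)                                      ≤⟨ Unique⇒count≤1 W! ⟩
    1                                                                       ∎))
    where open ≤-Reasoning

  count-sums-Tb≤count-skewList : ∀ a → count a (sums m Tb) ≤ count a skewList
  count-sums-Tb≤count-skewList a = ≤-trans (∑-mono (sums m Tb) (λ {s} _ → m≤m+n (δ s a) _))
    (≤-reflexive (sym (count-concatMap-pair id (neg m) (sums m Tb) a)))

  strong⇒W-strong : Strong n St → Unique (rsums 0) → Strong N W
  strong⇒W-strong (St≢0 , St!) rsums0! =
    count≡0⇒All≢ (sums N W) count-0 , count≤1⇒Unique (sums N W) (λ z → subst (λ z → count z (sums N W) ≤ 1)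
      (sym (digits n′ m′ z)) (count-digits≤1 (z / n) (m%n<n z n)))
    where
    count-sums-Tb+δ≤1 : ∀ a → count a (sums m Tb) + δ 0 a ≤ 1
    count-sums-Tb+δ≤1 a = ≤-trans (+-monoˡ-≤ (δ 0 a) (count-sums-Tb≤count-skewList a))
      (≤-trans (≤-reflexive (sym (count-rsums0 a))) (Unique⇒count≤1 rsums0!))
    count-digits≤ : ∀ a {b} → b < n → count (n * a + b) (sums N W) ≤ count b (sums n St) + count a (sums m Tb) * δ 0 b
    count-digits≤ a {b} b<n = begin
      count (n * a + b) (sums N W)                                                       ≡⟨ count-sums-W a b<n ⟩
      ∑ St (λ xy → count a (rsums (carry xy)) * δ (low xy) b) + count a (sums m Tb) * δ 0 b
        ≤⟨ +-monoˡ-≤ _ (∑-mono St (λ {xy} _ → *-monoˡ-≤ (δ (low xy) b)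
             (Unique⇒count≤1 (rsums-unique-shift 0 (carry xy) rsums0!)))) ⟩
      ∑ St (λ xy → 1 * δ (low xy) b) + count a (sums m Tb) * δ 0 b
        ≡⟨ cong (_+ count a (sums m Tb) * δ 0 b) (trans (∑-cong St (λ {xy} _ → *-identityˡ (δ (low xy) b))) (sym (∑-map (pairSum n) St _))) ⟩
      count b (sums n St) + count a (sums m Tb) * δ 0 b                                  ∎
      where open ≤-Reasoning
    count-digits≤1 : ∀ a {b} → b < n → count (n * a + b) (sums N W) ≤ 1
    count-digits≤1 a {zero} b<n = ≤-trans (count-digits≤ a b<n) (≤-trans (≤-reflexive
      (cong₂ _+_ (All≢⇒count≡0 St≢0) (trans (cong (count a (sums m Tb) *_) (δ-refl 0)) (*-identityʳ _))))
      (≤-trans (m≤m+n _ (δ 0 a)) (count-sums-Tb+δ≤1 a)))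
    count-digits≤1 a {suc b} b<n = ≤-trans (count-digits≤ a b<n) (≤-trans (≤-reflexive
      (cong₂ _+_ refl (trans (cong (count a (sums m Tb) *_) (δ-≢ {0} {suc b} (λ ()))) (*-zeroʳ (count a (sums m Tb))))))
      (≤-trans (≤-reflexive (+-identityʳ _)) (Unique⇒count≤1 St!)))
    count-0 : count 0 (sums N W) ≡ 0
    count-0 = n≤0⇒n≡0 (begin
      count 0 (sums N W)                                  ≡⟨ cong (λ z → count z (sums N W)) (trans (+-identityʳ (n * 0)) (*-zeroʳ n)) ⟨
      count (n * 0 + 0) (sums N W)                        ≤⟨ count-digits≤ 0 (s≤s z≤n) ⟩
      count 0 (sums n St) + count 0 (sums m Tb) * δ 0 0   ≡⟨ cong₂ (λ u v → u + count 0 (sums m Tb) * v) (All≢⇒count≡0 St≢0) (δ-refl 0) ⟩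
      count 0 (sums m Tb) * 1                             ≡⟨ *-identityʳ _ ⟩
      count 0 (sums m Tb)                                 ≤⟨ +-cancelʳ-≤ 1 _ _ (≤-trans (≤-reflexive (cong (count 0 (sums m Tb) +_) (sym (δ-refl 0)))) (count-sums-Tb+δ≤1 0)) ⟩
      0                                                   ∎)
      where open ≤-Reasoning

  W-strong⇒St-strong : Strong N W → Strong n St
  W-strong⇒St-strong W-strong = W-strong⇒St-nonzero W-strong , W-unique⇒St-unique (proj₂ W-strong)

theorem3p6 : (n m : ℕ) → 3 ≤ n → 3 ≤ m → md n 2 ≡ 1 → md m 2 ≡ 1 →
    (S T St Tb : Pairs) →
    IsTwoPartition n S → IsTwoPartition m T →
    IsOrdering S St → IsBarOrdering m T Tb →
    (IsTwoPartition (n * m) (product n m St Tb) × Strong (n * m) (product n m St Tb))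
      ⇔ (Strong n S × Skew m T)
theorem3p6 n@(suc (suc _)) (suc m′) (s≤s (s≤s _)) _ _ _ S T St Tb S-part T-part S~St (T~Tb , bar) =
  mk⇔ (λ (_ , W-strong) →
         Equivalence.from (Strong-ordering S~St) (W-strong⇒St-strong W-strong) ,
         Equivalence.from (Skew-ordering T~Tb)
           (Equivalence.from Skew⇔rsums-unique (W-unique⇒rsums-unique xy₀∈St (proj₂ W-strong))))
      (λ (S-strong , T-skew) →
         W-partition ,
         strong⇒W-strong (Equivalence.to (Strong-ordering S~St) S-strong)
           (Equivalence.to Skew⇔rsums-unique (Equivalence.to (Skew-ordering T~Tb) T-skew)))
  where
  St-part : IsTwoPartition n St
  St-part = partition-ordering n S~St S-part
  open Product (pred n) m′ St Tb St-part (partition-ordering (suc m′) T~Tb T-part)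
  open Coordinates bar
  xy₀∈St : proj₁ (partition-nonempty St St-part) ∈ St
  xy₀∈St = proj₂ (partition-nonempty St St-part)
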